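{- Let $m,n,h,k$ be integers with $m\ge h>1$ and $n\ge k>1$. Let $H$ be an $[h\text{ - }k]$-bipartite hypertournament with vertex sets $U=\{u_1,\dots,u_m\}$ and $V=\{v_1,\dots,v_n\}$, where $u_l$ has losing score $a_l$ ($1\le l\le m$) and $v_l$ has losing score $b_l$ ($1\le l\le n$). If $a_i<a_j$ for some indices $i\ne j$, then there is an $[h\text{ - }k]$-bipartite hypertournament $H'$ on the same vertex sets in which $u_i$ has losing score $a_i+1$, $u_j$ has losing score $a_j-1$, every other $u_l$ has losing score $a_l$, and every $v_l$ has losing score $b_l$.
   Context: An $[h\text{ - }k]$-bipartite hypertournament on vertex sets $U$ and $V$ (disjoint, $|U|=m$, $|V|=n$) consists of $U$, $V$ and a set of arcs, each arc being an ordered $(h+k)$-tuple of distinct vertices with exactly $h$ entries from $U$ and exactly $k$ entries from $V$, such that for every $h$-subset $U_1\subseteq U$ and every $k$-subset $V_1\subseteq V$, the arc set contains exactly one of the $(h+k)!$ orderings of $U_1\cup V_1$. The losing score of a vertex $w$ is the number of arcs containing $w$ in which $w$ is the last entry. -}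

module Defs where

open import Data.Nat using (ℕ)
open import Data.Fin using (Fin)
import Data.Fin as F
open import Data.Fin.Subset as S using (Subset; ∣_∣)
open import Data.Sum using (_⊎_; inj₁; inj₂; isInj₁; isInj₂)
import Data.Sum.Properties as SumP
open import Data.Maybe using (Maybe; just)
import Data.Maybe.Properties as MaybeP
open import Data.List using (List; length; filter; mapMaybe; last)
open import Data.List.Membership.Propositional using (_∈_)
open import Data.List.Relation.Unary.Unique.Propositional using (Unique)
open import Data.Product using (Σ; _×_; _,_)
open import Relation.Binary.PropositionalEquality using (_≡_)
open import Relation.Nullary using (Dec)

-- Vertices: U = Fin m (inj₁), V = Fin n (inj₂).
Vertex : ℕ → ℕ → Set
Vertex m n = Fin m ⊎ Fin n

Arc : ℕ → ℕ → Set
Arc m n = List (Vertex m n)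

IsArc : ∀ {m n} → ℕ → ℕ → Arc m n → Set
IsArc h k a = Unique a × length (mapMaybe isInj₁ a) ≡ h × length (mapMaybe isInj₂ a) ≡ k

InUnion : ∀ {m n} → Subset m → Subset n → Vertex m n → Set
InUnion U₁ V₁ (inj₁ x) = x S.∈ U₁
InUnion U₁ V₁ (inj₂ y) = y S.∈ V₁

OrderingOf : ∀ {m n} → Subset m → Subset n → Arc m n → Set
OrderingOf U₁ V₁ a = ∀ x → (x ∈ a → InUnion U₁ V₁ x) × (InUnion U₁ V₁ x → x ∈ a)

record BipartiteHypertournament (m n h k : ℕ) : Set where
  field
    arcs     : List (Arc m n)
    arcsSet  : Unique arcs
    arcValid : ∀ a → a ∈ arcs → IsArc h k a
    existsArc : ∀ (U₁ : Subset m) (V₁ : Subset n) → ∣ U₁ ∣ ≡ h → ∣ V₁ ∣ ≡ k →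
                Σ (Arc m n) λ a → a ∈ arcs × OrderingOf U₁ V₁ a
    uniqueArc : ∀ (U₁ : Subset m) (V₁ : Subset n) → ∣ U₁ ∣ ≡ h → ∣ V₁ ∣ ≡ k →
                ∀ a b → a ∈ arcs → b ∈ arcs → OrderingOf U₁ V₁ a → OrderingOf U₁ V₁ b → a ≡ b

open BipartiteHypertournament public

_≟V_ : ∀ {m n} (x y : Maybe (Vertex m n)) → Dec (x ≡ y)
_≟V_ = MaybeP.≡-dec (SumP.≡-dec F._≟_ F._≟_)

losingScore : ∀ {m n h k} → BipartiteHypertournament m n h k → Vertex m n → ℕ
losingScore H w = length (filter (λ a → last a ≟V just w) (arcs H))

module Submission where

-- Let τ be the transposition of uᵢ and uⱼ, and call A′ the partner of an arc A when A′ is the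
-- arc on the vertex set τ(A). Partnership is injective, so as more arcs end in uⱼ than in uᵢ,
-- some arc A ending in uⱼ has a partner A′ that does not end in uᵢ. Nor does A′ end in uⱼ unless
-- A′ = A: otherwise A contains both uᵢ and uⱼ, so its vertex set is τ-invariant. Replacing A by
-- τA′ and A′ by τA (just A by τA when A′ = A) still leaves exactly one arc on every vertex set;
-- it moves one loss from uⱼ to uᵢ, and no other, since τ fixes the last vertex of A′.

open import Defs
open import Algebra.Definitions using (Involutive)
open import Data.Nat using (ℕ; suc; _+_; _∸_; _≤_; _<_; z≤n; s≤s)
open import Data.Nat.Properties
  using (+-comm; +-assoc; +-identityʳ; +-cancelʳ-≡; m+n∸n≡m; ≤-trans; ≤-reflexive; <⇒≱; +-commutativeSemigroup)
open import Algebra.Properties.CommutativeSemigroup +-commutativeSemigroup using (xy∙z≈zy∙x; xy∙z≈xz∙y)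
open import Data.Nat.ListAction using (sum)
open import Data.Bool using (true; false; if_then_else_)
open import Data.Fin using (Fin; zero; suc)
import Data.Fin as F
open import Data.Fin.Permutation.Components using (transpose)
open import Data.Fin.Subset as S using (Subset; inside; outside; ⁅_⁆; _∪_; ⋃; ∣_∣)
open import Data.Fin.Subset.Properties using (∉⊥; ∣⊥∣≡0; ∪-identityˡ; x∈⁅x⁆; x∈⁅y⁆⇒x≡y; x∈p∪q⁺; x∈p∪q⁻)
open import Data.Vec using (_∷_; here; there)
open import Data.Sum using (_⊎_; inj₁; inj₂; isInj₁; isInj₂; map₁)
import Data.Sum.Properties as Sum
open import Data.Maybe using (Maybe; just; nothing)
import Data.Maybe as Maybe
open import Data.Maybe.Properties using (just-injective)
open import Data.List using (List; []; _∷_; length; map; filter; mapMaybe; last)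
open import Data.List.Properties
  using (length-removeAt′; map-cong-local; map-∘; map-cong; map-id; length-map; last-map)
import Data.List.Properties as List
open import Data.List.Relation.Unary.Any using (here; there)
import Data.List.Relation.Unary.Any as Any
open import Data.List.Relation.Unary.All using (_∷_)
import Data.List.Relation.Unary.All as All
import Data.List.Relation.Unary.All.Properties as All
open import Data.List.Relation.Unary.AllPairs using ([]; _∷_)
open import Data.List.Relation.Unary.Unique.Propositional using (Unique)
import Data.List.Relation.Unary.Unique.Propositional.Properties as Unique
open import Data.List.Membership.Propositional using (_∈_; _─_; find; lose)
open import Data.List.Membership.Propositional.Properties using (∈-map⁺; ∈-map⁻; ∈-filter⁺; ∈-filter⁻)
open import Data.List.Relation.Binary.BagAndSetEquality using (_∼[_]_; set; [_]-Equality)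
import Data.List.Relation.Binary.BagAndSetEquality as SetEq
import Data.List.Relation.Binary.Subset.DecPropositional as DecSubset
open import Data.Product using (Σ; ∃; _×_; _,_; proj₁; proj₂)
open import Function using (_∘_; id; case_of_)
open import Function.Bundles using (Equivalence; mk⇔)
open import Relation.Binary.Bundles using (Setoid)
open import Relation.Binary.Definitions using (DecidableEquality)
open import Relation.Binary.PropositionalEquality
open import Relation.Nullary using (Dec; does; yes; no; ¬_; contradiction)
open import Relation.Nullary.Decidable using (map′; _×-dec_; ¬?; dec-true; dec-false)
open import Relation.Unary using (Decidable)

private
  variable
    X Y : Set
    x y : X
    xs ys : List X

∈-─⁺ : (y∈ys : y ∈ ys) → x ∈ ys → x ≢ y → x ∈ ys ─ y∈ys
∈-─⁺ (here refl)  (here refl)  x≢y = contradiction refl x≢y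
∈-─⁺ (here _)     (there x∈ys) _   = x∈ys
∈-─⁺ (there _)    (here refl)  _   = here refl
∈-─⁺ (there y∈ys) (there x∈ys) x≢y = there (∈-─⁺ y∈ys x∈ys x≢y)

length-≤-by-injective-relation : (R : X → Y → Set) → Unique xs →
  (∀ {x} → x ∈ xs → ∃ λ y → y ∈ ys × R x y) →
  (∀ {x x′ y} → x ∈ xs → x′ ∈ xs → R x y → R x′ y → x ≡ x′) →
  length xs ≤ length ys
length-≤-by-injective-relation R [] _ _ = z≤n
length-≤-by-injective-relation {xs = x ∷ xs} {ys = ys} R (x∉xs ∷ u) related injective
  with related (here refl)
... | y , y∈ys , Rxy = ≤-trans (s≤s rest) (≤-reflexive (sym (length-removeAt′ ys _)))
  where
  related′ : ∀ {x′} → x′ ∈ xs → ∃ λ y′ → y′ ∈ ys ─ y∈ys × R x′ y′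
  related′ x′∈xs with related (there x′∈xs)
  ... | y′ , y′∈ys , Rx′y′ = y′ , ∈-─⁺ y∈ys y′∈ys y′≢y , Rx′y′
    where
    y′≢y : y′ ≢ y
    y′≢y refl = All.lookup x∉xs x′∈xs (injective (here refl) (there x′∈xs) Rxy Rx′y′)

  rest : length xs ≤ length (ys ─ y∈ys)
  rest = length-≤-by-injective-relation R u related′ (λ p q → injective (there p) (there q))

Unique-map⁺-on : (f : X → Y) → (∀ {x y} → x ∈ xs → y ∈ xs → f x ≡ f y → x ≡ y) →
  Unique xs → Unique (map f xs)
Unique-map⁺-on f injective [] = []
Unique-map⁺-on f injective (x∉xs ∷ u) =
  All.map⁺ (All.tabulate λ y∈xs fx≡fy → All.lookup x∉xs y∈xs (injective (here refl) (there y∈xs) fx≡fy))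
  ∷ Unique-map⁺-on f (λ p q → injective (there p) (there q)) u

last-∈ : (xs : List X) → last xs ≡ just x → x ∈ xs
last-∈ (_ ∷ [])         refl = here refl
last-∈ (_ ∷ xs@(_ ∷ _)) eq   = there (last-∈ xs eq)

set-equal? : DecidableEquality X → (xs ys : List X) → Dec (xs ∼[ set ] ys)
set-equal? _≟_ xs ys = map′ fromPair toPair (xs ⊆? ys ×-dec ys ⊆? xs)
  where
  open DecSubset _≟_ using (_⊆_; _⊆?_)
  fromPair : xs ⊆ ys × ys ⊆ xs → xs ∼[ set ] ys
  fromPair (xs⊆ys , ys⊆xs) = mk⇔ xs⊆ys ys⊆xs
  toPair : xs ∼[ set ] ys → xs ⊆ ys × ys ⊆ xs
  toPair xs∼ys = Equivalence.to xs∼ys , Equivalence.from xs∼ys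

module _ {f : X → Maybe Y} {g : Y → X}
         (f∘g : ∀ b → f (g b) ≡ just b) (f≡just⇒ : ∀ {a b} → f a ≡ just b → a ≡ g b) where

  ∈-mapMaybe⁺ : ∀ {b xs} → g b ∈ xs → b ∈ mapMaybe f xs
  ∈-mapMaybe⁺ {b} (here refl) rewrite f∘g b = here refl
  ∈-mapMaybe⁺ {xs = x ∷ _} (there gb∈xs) with f x
  ... | nothing = ∈-mapMaybe⁺ gb∈xs
  ... | just _  = there (∈-mapMaybe⁺ gb∈xs)

  ∈-mapMaybe⁻ : ∀ {b} xs → b ∈ mapMaybe f xs → g b ∈ xs
  ∈-mapMaybe⁻ (x ∷ xs) b∈ with f x in fx≡
  ... | nothing = there (∈-mapMaybe⁻ xs b∈)
  ∈-mapMaybe⁻ (x ∷ xs) (here refl) | just _ = here (sym (f≡just⇒ fx≡))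
  ∈-mapMaybe⁻ (x ∷ xs) (there b∈)  | just _ = there (∈-mapMaybe⁻ xs b∈)

  Unique-mapMaybe : ∀ {xs} → Unique xs → Unique (mapMaybe f xs)
  Unique-mapMaybe [] = []
  Unique-mapMaybe {x ∷ xs} (x∉xs ∷ u) with f x in fx≡
  ... | nothing = Unique-mapMaybe u
  ... | just b  = All.tabulate b∉ ∷ Unique-mapMaybe u
    where
    b∉ : ∀ {b′} → b′ ∈ mapMaybe f xs → b ≢ b′
    b∉ b′∈ refl = All.lookup x∉xs (∈-mapMaybe⁻ xs b′∈) (f≡just⇒ fx≡)

indicator : {P : Set} → Dec P → ℕ
indicator P? = if does P? then 1 else 0

indicator-yes : {P : Set} (P? : Dec P) → P → indicator P? ≡ 1
indicator-yes P? p rewrite dec-true P? p = refl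

indicator-no : {P : Set} (P? : Dec P) → ¬ P → indicator P? ≡ 0
indicator-no P? ¬p rewrite dec-false P? ¬p = refl

length-filter≡sum-indicator : {P : X → Set} (P? : Decidable P) (xs : List X) →
  length (filter P? xs) ≡ sum (map (indicator ∘ P?) xs)
length-filter≡sum-indicator P? [] = refl
length-filter≡sum-indicator P? (x ∷ xs) with does (P? x)
... | true  = cong suc (length-filter≡sum-indicator P? xs)
... | false = length-filter≡sum-indicator P? xs

sum-map-except : (φ ψ : X → ℕ) {a : X} → Unique xs → a ∈ xs →
  (∀ {x} → x ∈ xs → x ≢ a → φ x ≡ ψ x) →
  sum (map φ xs) + ψ a ≡ sum (map ψ xs) + φ a
sum-map-except {xs = x ∷ xs} φ ψ (x∉xs ∷ _) (here refl) agree = begin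
  φ x + sum (map φ xs) + ψ x ≡⟨ cong (λ s → φ x + s + ψ x) rest ⟩
  φ x + sum (map ψ xs) + ψ x ≡⟨ xy∙z≈zy∙x (φ x) _ (ψ x) ⟩
  ψ x + sum (map ψ xs) + φ x ∎
  where
  open ≡-Reasoning
  rest : sum (map φ xs) ≡ sum (map ψ xs)
  rest = cong sum (map-cong-local (All.tabulate λ y∈xs →
    agree (there y∈xs) (λ { refl → All.lookup x∉xs y∈xs refl })))
sum-map-except {xs = x ∷ xs} φ ψ {a} (x∉xs ∷ u) (there a∈xs) agree = begin
  φ x + sum (map φ xs) + ψ a   ≡⟨ +-assoc (φ x) _ _ ⟩
  φ x + (sum (map φ xs) + ψ a) ≡⟨ cong₂ _+_ (agree (here refl) (All.lookup x∉xs a∈xs))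
                                            (sum-map-except φ ψ u a∈xs (agree ∘ there)) ⟩
  ψ x + (sum (map ψ xs) + φ a) ≡⟨ +-assoc (ψ x) _ _ ⟨
  ψ x + sum (map ψ xs) + φ a   ∎
  where open ≡-Reasoning

module FunctionUpdate {X : Set} (_≟_ : DecidableEquality X) where

  infixl 9 _[_↦_]
  _[_↦_] : (X → Y) → X → Y → X → Y
  (f [ a ↦ b ]) x = if does (x ≟ a) then b else f x

  update-≡ : (f : X → Y) (a : X) {b : Y} → (f [ a ↦ b ]) a ≡ b
  update-≡ f a rewrite dec-true (a ≟ a) refl = refl

  update-≢ : (f : X → Y) {a : X} {b : Y} {x : X} → x ≢ a → (f [ a ↦ b ]) x ≡ f x
  update-≢ f {a} {x = x} x≢a rewrite dec-false (x ≟ a) x≢a = refl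

∣⁅x⁆∪p∣≡suc∣p∣ : ∀ {r} {x : Fin r} {p : Subset r} → x S.∉ p → ∣ ⁅ x ⁆ ∪ p ∣ ≡ suc ∣ p ∣
∣⁅x⁆∪p∣≡suc∣p∣ {x = zero}  {outside ∷ p} _   = cong (suc ∘ ∣_∣) (∪-identityˡ p)
∣⁅x⁆∪p∣≡suc∣p∣ {x = zero}  {inside ∷ p}  x∉p = contradiction here x∉p
∣⁅x⁆∪p∣≡suc∣p∣ {x = suc x} {outside ∷ p} x∉p = ∣⁅x⁆∪p∣≡suc∣p∣ (x∉p ∘ there)
∣⁅x⁆∪p∣≡suc∣p∣ {x = suc x} {inside ∷ p}  x∉p = cong suc (∣⁅x⁆∪p∣≡suc∣p∣ (x∉p ∘ there))

fromList : ∀ {r} → List (Fin r) → Subset r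
fromList xs = ⋃ (map ⁅_⁆ xs)

∈-fromList⁺ : ∀ {r} {x : Fin r} {xs} → x ∈ xs → x S.∈ fromList xs
∈-fromList⁺ (here refl)  = x∈p∪q⁺ (inj₁ (x∈⁅x⁆ _))
∈-fromList⁺ (there x∈xs) = x∈p∪q⁺ (inj₂ (∈-fromList⁺ x∈xs))

∈-fromList⁻ : ∀ {r} {x : Fin r} {xs} → x S.∈ fromList xs → x ∈ xs
∈-fromList⁻ {xs = []} x∈⊥ = contradiction x∈⊥ ∉⊥
∈-fromList⁻ {xs = y ∷ ys} x∈ with x∈p∪q⁻ ⁅ y ⁆ (fromList ys) x∈
... | inj₁ x∈⁅y⁆ = here (x∈⁅y⁆⇒x≡y y x∈⁅y⁆)
... | inj₂ x∈ys  = there (∈-fromList⁻ x∈ys)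

∣fromList∣ : ∀ {r} {xs : List (Fin r)} → Unique xs → ∣ fromList xs ∣ ≡ length xs
∣fromList∣ {r} [] = ∣⊥∣≡0 r
∣fromList∣ (x∉xs ∷ u) = trans (∣⁅x⁆∪p∣≡suc∣p∣ (All.All¬⇒¬Any x∉xs ∘ ∈-fromList⁻)) (cong suc (∣fromList∣ u))

module _ {m n : ℕ} where

  private
    isInj₁-just⇒ : ∀ {v : Vertex m n} {x} → isInj₁ v ≡ just x → v ≡ inj₁ x
    isInj₁-just⇒ {inj₁ _} refl = refl

    isInj₂-just⇒ : ∀ {v : Vertex m n} {y} → isInj₂ v ≡ just y → v ≡ inj₂ y
    isInj₂-just⇒ {inj₂ _} refl = refl

  uSet : Arc m n → Subset m
  uSet a = fromList (mapMaybe isInj₁ a)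

  vSet : Arc m n → Subset n
  vSet a = fromList (mapMaybe isInj₂ a)

  orderingOf-vertexSets : (a : Arc m n) → OrderingOf (uSet a) (vSet a) a
  orderingOf-vertexSets a (inj₁ x) =
    ∈-fromList⁺ ∘ ∈-mapMaybe⁺ (λ _ → refl) isInj₁-just⇒ ,
    ∈-mapMaybe⁻ (λ _ → refl) isInj₁-just⇒ a ∘ ∈-fromList⁻
  orderingOf-vertexSets a (inj₂ y) =
    ∈-fromList⁺ ∘ ∈-mapMaybe⁺ (λ _ → refl) isInj₂-just⇒ ,
    ∈-mapMaybe⁻ (λ _ → refl) isInj₂-just⇒ a ∘ ∈-fromList⁻

  ∣uSet∣ : ∀ {h k} {a : Arc m n} → IsArc h k a → ∣ uSet a ∣ ≡ h
  ∣uSet∣ (u , #U≡h , _) = trans (∣fromList∣ (Unique-mapMaybe (λ _ → refl) isInj₁-just⇒ u)) #U≡h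

  ∣vSet∣ : ∀ {h k} {a : Arc m n} → IsArc h k a → ∣ vSet a ∣ ≡ k
  ∣vSet∣ (u , _ , #V≡k) = trans (∣fromList∣ (Unique-mapMaybe (λ _ → refl) isInj₂-just⇒ u)) #V≡k

  open Setoid ([ set ]-Equality (Vertex m n)) public
    using () renaming (refl to ∼-refl; sym to ∼-sym; trans to ∼-trans)

  orderingOf-resp : ∀ {U V} {a b : Arc m n} → OrderingOf U V a → a ∼[ set ] b → OrderingOf U V b
  orderingOf-resp ord a∼b v = proj₁ (ord v) ∘ Equivalence.from a∼b , Equivalence.to a∼b ∘ proj₂ (ord v)

  orderingOf-unique : ∀ {U V} {a b : Arc m n} → OrderingOf U V a → OrderingOf U V b → a ∼[ set ] b
  orderingOf-unique ordA ordB {v} = mk⇔ (proj₂ (ordB v) ∘ proj₁ (ordA v)) (proj₂ (ordA v) ∘ proj₁ (ordB v))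

module _ {m n h k : ℕ} (H : BipartiteHypertournament m n h k) where

  arc-unique : ∀ {a b} → a ∈ arcs H → b ∈ arcs H → a ∼[ set ] b → a ≡ b
  arc-unique {a} a∈H b∈H a∼b =
    uniqueArc H (uSet a) (vSet a) (∣uSet∣ isArc) (∣vSet∣ isArc) _ _ a∈H b∈H
      (orderingOf-vertexSets a) (orderingOf-resp (orderingOf-vertexSets a) a∼b)
    where
    isArc : IsArc h k a
    isArc = arcValid H a a∈H

  arc-exists : ∀ {c} → IsArc h k c → ∃ λ a → a ∈ arcs H × a ∼[ set ] c
  arc-exists {c} isArc with existsArc H (uSet c) (vSet c) (∣uSet∣ isArc) (∣vSet∣ isArc)
  ... | a , a∈H , ordA = a , a∈H , orderingOf-unique ordA (orderingOf-vertexSets c)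

  replaceArcs : (g : Arc m n → Arc m n) → (∀ {a} → a ∈ arcs H → g a ∼[ set ] a × IsArc h k (g a)) →
    BipartiteHypertournament m n h k
  replaceArcs g valid = record
    { arcs      = map g (arcs H)
    ; arcsSet   = Unique-map⁺-on g g-injective (arcsSet H)
    ; arcValid  = λ _ ga∈ → case ∈-map⁻ g ga∈ of λ { (a , a∈H , refl) → proj₂ (valid a∈H) }
    ; existsArc = λ U V #U #V → case existsArc H U V #U #V of λ { (a , a∈H , ordA) →
                    g a , ∈-map⁺ g a∈H , orderingOf-resp ordA (∼-sym (proj₁ (valid a∈H))) }
    ; uniqueArc = λ U V #U #V _ _ ga∈ gb∈ ordA ordB → case ∈-map⁻ g ga∈ , ∈-map⁻ g gb∈ of λ
                    { ((a , a∈H , refl) , (b , b∈H , refl)) → cong g (uniqueArc H U V #U #V a b a∈H b∈H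
                        (orderingOf-resp ordA (proj₁ (valid a∈H))) (orderingOf-resp ordB (proj₁ (valid b∈H)))) }
    }
    where
    g-injective : ∀ {a b} → a ∈ arcs H → b ∈ arcs H → g a ≡ g b → a ≡ b
    g-injective a∈H b∈H ga≡gb = arc-unique a∈H b∈H
      (∼-trans (∼-sym (proj₁ (valid a∈H))) (subst (_∼[ set ] _) (sym ga≡gb) (proj₁ (valid b∈H))))

module Relabel {m n : ℕ} (σ : Fin m → Fin m) (σ-involutive : Involutive _≡_ σ) where

  σ̂ : Vertex m n → Vertex m n
  σ̂ = map₁ σ

  σ̂-involutive : Involutive _≡_ σ̂
  σ̂-involutive (inj₁ x) = cong inj₁ (σ-involutive x)
  σ̂-involutive (inj₂ y) = refl

  relabel : Arc m n → Arc m n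
  relabel = map σ̂

  relabel-involutive : Involutive _≡_ relabel
  relabel-involutive a = trans (sym (map-∘ a)) (trans (map-cong σ̂-involutive a) (map-id a))

  ∈-relabel⁺ : ∀ {v a} → σ̂ v ∈ a → v ∈ relabel a
  ∈-relabel⁺ {v} {a} σ̂v∈a = subst (_∈ relabel a) (σ̂-involutive v) (∈-map⁺ σ̂ σ̂v∈a)

  ∈-relabel⁻ : ∀ {v a} → v ∈ relabel a → σ̂ v ∈ a
  ∈-relabel⁻ {a = a} v∈ with ∈-map⁻ σ̂ v∈
  ... | w , w∈a , refl = subst (_∈ a) (sym (σ̂-involutive w)) w∈a

  relabel-cong : ∀ {a b} → a ∼[ set ] b → relabel a ∼[ set ] relabel b
  relabel-cong = SetEq.map-cong (λ _ → refl)

  private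
    U-part-relabel : ∀ a → mapMaybe isInj₁ (relabel a) ≡ map σ (mapMaybe isInj₁ a)
    U-part-relabel []           = refl
    U-part-relabel (inj₁ x ∷ a) = cong (σ x ∷_) (U-part-relabel a)
    U-part-relabel (inj₂ _ ∷ a) = U-part-relabel a

    V-part-relabel : ∀ a → mapMaybe isInj₂ (relabel a) ≡ mapMaybe isInj₂ a
    V-part-relabel []           = refl
    V-part-relabel (inj₁ _ ∷ a) = V-part-relabel a
    V-part-relabel (inj₂ y ∷ a) = cong (y ∷_) (V-part-relabel a)

    σ̂-injective : ∀ {v w} → σ̂ v ≡ σ̂ w → v ≡ w
    σ̂-injective {v} {w} e = trans (sym (σ̂-involutive v)) (trans (cong σ̂ e) (σ̂-involutive w))

  relabel-IsArc : ∀ {h k a} → IsArc h k a → IsArc h k (relabel a)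
  relabel-IsArc {a = a} (u , #U , #V) =
    Unique.map⁺ σ̂-injective u ,
    trans (cong length (U-part-relabel a)) (trans (length-map σ (mapMaybe isInj₁ a)) #U) ,
    trans (cong length (V-part-relabel a)) #V

  relabel-closed : ∀ {a} → (∀ {v} → v ∈ a → σ̂ v ∈ a) → relabel a ∼[ set ] a
  relabel-closed {a} closed {v} = mk⇔ (λ v∈ → subst (_∈ a) (σ̂-involutive v) (closed (∈-relabel⁻ v∈)))
                                       (∈-relabel⁺ ∘ closed)

  ∼-relabel-swap : ∀ {a b} → a ∼[ set ] relabel b → relabel a ∼[ set ] b
  ∼-relabel-swap {a} {b} a∼τb = subst (relabel a ∼[ set ]_) (relabel-involutive b) (relabel-cong a∼τb)

  relabel-injective-∼ : ∀ {a b} → relabel a ∼[ set ] relabel b → a ∼[ set ] b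
  relabel-injective-∼ {a} {b} τa∼τb = subst (_∼[ set ] b) (relabel-involutive a) (∼-relabel-swap τa∼τb)

module _ {m : ℕ} (i j : Fin m) where

  transpose-i : transpose i j i ≡ j
  transpose-i rewrite dec-true (i F.≟ i) refl = refl

  transpose-j : transpose i j j ≡ i
  transpose-j = by-cases (j F.≟ i)
    where
    by-cases : Dec (j ≡ i) → transpose i j j ≡ i
    by-cases (yes j≡i) rewrite dec-true (j F.≟ i) j≡i = j≡i
    by-cases (no j≢i) rewrite dec-false (j F.≟ i) j≢i | dec-true (j F.≟ j) refl = refl

  transpose-other : ∀ {k} → k ≢ i → k ≢ j → transpose i j k ≡ k
  transpose-other {k} k≢i k≢j rewrite dec-false (k F.≟ i) k≢i | dec-false (k F.≟ j) k≢j = refl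

  transpose-involutive : Involutive _≡_ (transpose i j)
  transpose-involutive k = by-cases k (k F.≟ i) (k F.≟ j)
    where
    by-cases : ∀ k → Dec (k ≡ i) → Dec (k ≡ j) → transpose i j (transpose i j k) ≡ k
    by-cases _ (yes refl) _          = trans (cong (transpose i j) transpose-i) transpose-j
    by-cases _ (no _)     (yes refl) = trans (cong (transpose i j) transpose-j) transpose-i
    by-cases k (no k≢i)   (no k≢j)   =
      trans (cong (transpose i j) (transpose-other k≢i k≢j)) (transpose-other k≢i k≢j)

  transpose-∈ : ∀ k → transpose i j k ≡ i ⊎ transpose i j k ≡ j ⊎ transpose i j k ≡ k
  transpose-∈ k = by-cases k (k F.≟ i) (k F.≟ j)
    where
    by-cases : ∀ k → Dec (k ≡ i) → Dec (k ≡ j) →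
      transpose i j k ≡ i ⊎ transpose i j k ≡ j ⊎ transpose i j k ≡ k
    by-cases _ (yes refl) _          = inj₂ (inj₁ transpose-i)
    by-cases _ (no _)     (yes refl) = inj₁ transpose-j
    by-cases k (no k≢i)   (no k≢j)   = inj₂ (inj₂ (transpose-other k≢i k≢j))

_≟ᵥ_ : ∀ {m n} → DecidableEquality (Vertex m n)
_≟ᵥ_ = Sum.≡-dec F._≟_ F._≟_

_≟ₐ_ : ∀ {m n} → DecidableEquality (Arc m n)
_≟ₐ_ = List.≡-dec _≟ᵥ_

lastIs? : ∀ {m n} (w : Vertex m n) (a : Arc m n) → Dec (last a ≡ just w)
lastIs? w a = last a ≟V just w

lastIs : ∀ {m n} → Vertex m n → Arc m n → ℕ
lastIs w = indicator ∘ lastIs? w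

lastIs-yes : ∀ {m n} {w : Vertex m n} (a : Arc m n) → last a ≡ just w → lastIs w a ≡ 1
lastIs-yes {w = w} a = indicator-yes (lastIs? w a)

lastIs-no : ∀ {m n} {v w : Vertex m n} (a : Arc m n) → last a ≡ just v → v ≢ w → lastIs w a ≡ 0
lastIs-no {w = w} a a-last v≢w = indicator-no (lastIs? w a) (v≢w ∘ just-injective ∘ trans (sym a-last))

losingScore≡sum : ∀ {m n h k} (H : BipartiteHypertournament m n h k) w →
  losingScore H w ≡ sum (map (lastIs w) (arcs H))
losingScore≡sum H w = length-filter≡sum-indicator (lastIs? w) (arcs H)

module Exchange {m n h k : ℕ} (H : BipartiteHypertournament m n h k) (i j : Fin m) where

  open Relabel {n = n} (transpose i j) (transpose-involutive i j)

  uᵢ uⱼ : Vertex m n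
  uᵢ = inj₁ i
  uⱼ = inj₁ j

  record ExchangeablePair : Set where
    field
      A A′       : Arc m n
      A∈H        : A ∈ arcs H
      A-lastⱼ    : last A ≡ just uⱼ
      A′∈H       : A′ ∈ arcs H
      A′∼τA      : A′ ∼[ set ] relabel A
      A′-last≢ᵢ  : last A′ ≢ just uᵢ

  GoodPartner : Arc m n → Arc m n → Set
  GoodPartner A A′ = A′ ∼[ set ] relabel A × last A′ ≢ just uᵢ

  Exchangeable : Set
  Exchangeable = Any.Any (λ A → last A ≡ just uⱼ × Any.Any (GoodPartner A) (arcs H)) (arcs H)

  exchangeable? : Dec Exchangeable
  exchangeable? = Any.any? (λ A → lastIs? uⱼ A ×-dec Any.any? (partner? A) (arcs H)) (arcs H)
    where
    partner? : ∀ A A′ → Dec (GoodPartner A A′)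
    partner? A A′ = set-equal? _≟ᵥ_ A′ (relabel A) ×-dec ¬? (lastIs? uᵢ A′)

  fromExchangeable : Exchangeable → ExchangeablePair
  fromExchangeable ex with find ex
  ... | A , A∈H , A-lastⱼ , partners with find partners
  ...   | A′ , A′∈H , A′∼τA , A′-last≢ᵢ = record
    { A = A ; A′ = A′ ; A∈H = A∈H ; A-lastⱼ = A-lastⱼ
    ; A′∈H = A′∈H ; A′∼τA = A′∼τA ; A′-last≢ᵢ = A′-last≢ᵢ }

  ¬exchangeable⇒score-uⱼ≤score-uᵢ : ¬ Exchangeable → losingScore H uⱼ ≤ losingScore H uᵢ
  ¬exchangeable⇒score-uⱼ≤score-uᵢ ¬ex =
    length-≤-by-injective-relation (λ A A′ → A′ ∼[ set ] relabel A)
      (Unique.filter⁺ _ (arcsSet H)) partner injective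
    where
    partner : ∀ {A} → A ∈ filter (lastIs? uⱼ) (arcs H) →
      ∃ λ A′ → A′ ∈ filter (lastIs? uᵢ) (arcs H) × A′ ∼[ set ] relabel A
    partner {A} A∈ with ∈-filter⁻ (lastIs? uⱼ) A∈
    ... | A∈H , A-lastⱼ with arc-exists H (relabel-IsArc (arcValid H A A∈H))
    ...   | A′ , A′∈H , A′∼τA with lastIs? uᵢ A′
    ...     | yes A′-lastᵢ = A′ , ∈-filter⁺ (lastIs? uᵢ) A′∈H A′-lastᵢ , A′∼τA
    ...     | no A′-last≢ᵢ =
      contradiction (lose A∈H (A-lastⱼ , lose {P = GoodPartner A} A′∈H (A′∼τA , A′-last≢ᵢ))) ¬ex

    injective : ∀ {A B A′} → A ∈ filter (lastIs? uⱼ) (arcs H) → B ∈ filter (lastIs? uⱼ) (arcs H) →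
      A′ ∼[ set ] relabel A → A′ ∼[ set ] relabel B → A ≡ B
    injective A∈ B∈ A′∼τA A′∼τB =
      arc-unique H (proj₁ (∈-filter⁻ (lastIs? uⱼ) A∈)) (proj₁ (∈-filter⁻ (lastIs? uⱼ) B∈))
        (relabel-injective-∼ (∼-trans (∼-sym A′∼τA) A′∼τB))

  exchangeable : losingScore H uᵢ < losingScore H uⱼ → ExchangeablePair
  exchangeable score-uᵢ<score-uⱼ with exchangeable?
  ... | yes ex = fromExchangeable ex
  ... | no ¬ex = contradiction (¬exchangeable⇒score-uⱼ≤score-uᵢ ¬ex) (<⇒≱ score-uᵢ<score-uⱼ)

  ∈∧∈⇒relabel-∼ : ∀ {a} → uᵢ ∈ a → uⱼ ∈ a → relabel a ∼[ set ] a
  ∈∧∈⇒relabel-∼ {a} uᵢ∈a uⱼ∈a = relabel-closed closed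
    where
    closed : ∀ {v} → v ∈ a → σ̂ v ∈ a
    closed {inj₂ _} v∈a = v∈a
    closed {inj₁ x} v∈a with transpose-∈ i j x
    ... | inj₁ τx≡i        = subst (λ y → inj₁ y ∈ a) (sym τx≡i) uᵢ∈a
    ... | inj₂ (inj₁ τx≡j) = subst (λ y → inj₁ y ∈ a) (sym τx≡j) uⱼ∈a
    ... | inj₂ (inj₂ τx≡x) = subst (λ y → inj₁ y ∈ a) (sym τx≡x) v∈a

  σ̂-fixes : ∀ {v} → v ≢ uᵢ → v ≢ uⱼ → σ̂ v ≡ v
  σ̂-fixes {inj₁ x} v≢uᵢ v≢uⱼ = cong inj₁ (transpose-other i j (v≢uᵢ ∘ cong inj₁) (v≢uⱼ ∘ cong inj₁))
  σ̂-fixes {inj₂ _} _    _    = refl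

  module Exchanged (E : ExchangeablePair) where

    open ExchangeablePair E
    open FunctionUpdate (_≟ₐ_ {m} {n})

    A′≢A⇒A′-last≢ⱼ : A′ ≢ A → last A′ ≢ just uⱼ
    A′≢A⇒A′-last≢ⱼ A′≢A A′-lastⱼ =
      A′≢A (arc-unique H A′∈H A∈H (∼-trans A′∼τA (∈∧∈⇒relabel-∼ uᵢ∈A (last-∈ A A-lastⱼ))))
      where
      uᵢ∈A : uᵢ ∈ A
      uᵢ∈A = subst (λ y → inj₁ y ∈ A) (transpose-j i j) (∈-relabel⁻ (Equivalence.to A′∼τA (last-∈ A′ A′-lastⱼ)))

    last-relabel-A′ : A′ ≢ A → last (relabel A′) ≡ last A′
    last-relabel-A′ A′≢A = trans (last-map σ̂ A′) (fixed (last A′) refl)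
      where
      fixed : ∀ l → last A′ ≡ l → Maybe.map σ̂ l ≡ l
      fixed nothing  _          = refl
      fixed (just v) A′-last≡v  = cong just (σ̂-fixes (A′-last≢ᵢ ∘ trans A′-last≡v ∘ cong just)
                                                    (A′≢A⇒A′-last≢ⱼ A′≢A ∘ trans A′-last≡v ∘ cong just))

    exchange₁ exchange : Arc m n → Arc m n
    exchange₁ = id [ A ↦ relabel A′ ]
    exchange  = exchange₁ [ A′ ↦ relabel A ]

    exchange-valid : ∀ {X} → X ∈ arcs H → exchange X ∼[ set ] X × IsArc h k (exchange X)
    exchange-valid {X} X∈H with X ≟ₐ A′ | X ≟ₐ A
    ... | yes refl | _        = ∼-sym A′∼τA , relabel-IsArc (arcValid H A A∈H)
    ... | no _     | yes refl = ∼-relabel-swap A′∼τA , relabel-IsArc (arcValid H A′ A′∈H)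
    ... | no _     | no _     = ∼-refl , arcValid H X X∈H

    H′ : BipartiteHypertournament m n h k
    H′ = replaceArcs H exchange exchange-valid

    score-shift : ∀ w → losingScore H′ w + lastIs w A ≡ losingScore H w + lastIs w (relabel A)
    score-shift w = begin
      losingScore H′ w + f A ≡⟨ cong (_+ f A) (trans (losingScore≡sum H′ w) (cong sum (sym (map-∘ (arcs H))))) ⟩
      S f′ + f A             ≡⟨ +-cancelʳ-≡ (f (relabel A′)) _ _ shifted ⟩
      S f + f (relabel A)    ≡⟨ cong (_+ f (relabel A)) (losingScore≡sum H w) ⟨
      losingScore H w + f (relabel A) ∎
      where
      open ≡-Reasoning
      f f₁ f′ : Arc m n → ℕ
      f  = lastIs w
      f₁ = f ∘ exchange₁
      f′ = f ∘ exchange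
      S : (Arc m n → ℕ) → ℕ
      S φ = sum (map φ (arcs H))

      step₁ : S f₁ + f A ≡ S f + f (relabel A′)
      step₁ = trans (sum-map-except f₁ f (arcsSet H) A∈H (λ _ → cong f ∘ update-≢ id))
                    (cong (λ a → S f + f a) (update-≡ id A))

      step₂ : S f′ + f₁ A′ ≡ S f₁ + f (relabel A)
      step₂ = trans (sum-map-except f′ f₁ (arcsSet H) A′∈H (λ _ → cong f ∘ update-≢ exchange₁))
                    (cong (λ a → S f₁ + f a) (update-≡ exchange₁ A′))

      f₁A′≡fτA′ : f₁ A′ ≡ f (relabel A′)
      f₁A′≡fτA′ with A′ ≟ₐ A
      ... | yes _   = refl
      ... | no A′≢A = cong (indicator ∘ (_≟V just w)) (sym (last-relabel-A′ A′≢A))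

      shifted : S f′ + f A + f (relabel A′) ≡ S f + f (relabel A) + f (relabel A′)
      shifted = begin
        S f′ + f A + f (relabel A′)           ≡⟨ xy∙z≈xz∙y (S f′) _ _ ⟩
        S f′ + f (relabel A′) + f A           ≡⟨ cong (λ t → S f′ + t + f A) f₁A′≡fτA′ ⟨
        S f′ + f₁ A′ + f A                    ≡⟨ cong (_+ f A) step₂ ⟩
        S f₁ + f (relabel A) + f A            ≡⟨ xy∙z≈xz∙y (S f₁) _ _ ⟩
        S f₁ + f A + f (relabel A)            ≡⟨ cong (_+ f (relabel A)) step₁ ⟩
        S f + f (relabel A′) + f (relabel A)  ≡⟨ xy∙z≈xz∙y (S f) _ _ ⟩
        S f + f (relabel A) + f (relabel A′)  ∎

    relabel-A-last : last (relabel A) ≡ just uᵢ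
    relabel-A-last =
      trans (last-map σ̂ A) (trans (cong (Maybe.map σ̂) A-lastⱼ) (cong (just ∘ inj₁) (transpose-j i j)))

    module _ (i≢j : i ≢ j) where

      private
        uᵢ≢uⱼ : uᵢ ≢ uⱼ
        uᵢ≢uⱼ = i≢j ∘ Sum.inj₁-injective

        score-shift-by : ∀ {w p q} → lastIs w A ≡ p → lastIs w (relabel A) ≡ q →
          losingScore H′ w + p ≡ losingScore H w + q
        score-shift-by {w} refl refl = score-shift w

      score-uᵢ : losingScore H′ uᵢ ≡ suc (losingScore H uᵢ)
      score-uᵢ = trans (sym (+-identityʳ _)) (trans
        (score-shift-by (lastIs-no A A-lastⱼ (uᵢ≢uⱼ ∘ sym)) (lastIs-yes (relabel A) relabel-A-last))
        (+-comm _ 1))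

      score-uⱼ : losingScore H′ uⱼ ≡ losingScore H uⱼ ∸ 1
      score-uⱼ = trans (sym (m+n∸n≡m _ 1)) (cong (_∸ 1) (trans
        (score-shift-by (lastIs-yes A A-lastⱼ) (lastIs-no (relabel A) relabel-A-last uᵢ≢uⱼ))
        (+-identityʳ _)))

      score-other : ∀ {w} → w ≢ uᵢ → w ≢ uⱼ → losingScore H′ w ≡ losingScore H w
      score-other w≢uᵢ w≢uⱼ = trans (sym (+-identityʳ _)) (trans
        (score-shift-by (lastIs-no A A-lastⱼ (w≢uⱼ ∘ sym)) (lastIs-no (relabel A) relabel-A-last (w≢uᵢ ∘ sym)))
        (+-identityʳ _))

lemma2p2 : ∀ (m n h k : ℕ) → 2 ≤ h → h ≤ m → 2 ≤ k → k ≤ n →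
    (H : BipartiteHypertournament m n h k) →
    (a : Fin m → ℕ) → (b : Fin n → ℕ) →
    (∀ l → losingScore H (inj₁ l) ≡ a l) → (∀ l → losingScore H (inj₂ l) ≡ b l) →
    (i j : Fin m) → i ≢ j → a i < a j →
    Σ (BipartiteHypertournament m n h k) λ H' →
      losingScore H' (inj₁ i) ≡ suc (a i) ×
      losingScore H' (inj₁ j) ≡ a j ∸ 1 ×
      (∀ l → l ≢ i → l ≢ j → losingScore H' (inj₁ l) ≡ a l) ×
      (∀ l → losingScore H' (inj₂ l) ≡ b l)
lemma2p2 m n h k _ _ _ _ H a b score≡a score≡b i j i≢j aᵢ<aⱼ =
  H′ ,
  trans (score-uᵢ i≢j) (cong suc (score≡a i)) ,
  trans (score-uⱼ i≢j) (cong (_∸ 1) (score≡a j)) ,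
  (λ l l≢i l≢j → trans (score-other i≢j (l≢i ∘ Sum.inj₁-injective) (l≢j ∘ Sum.inj₁-injective)) (score≡a l)) ,
  (λ l → trans (score-other i≢j (λ ()) (λ ())) (score≡b l))
  where
  open Exchange H i j
  open Exchanged (exchangeable (subst₂ _<_ (sym (score≡a i)) (sym (score≡a j)) aᵢ<aⱼ))
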